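{- For every integer $d\ge1$, let $Q_d(n)$ be the polynomial with rational coefficients such that $|P_n^d|=Q_d(n)$ for all integers $n\ge 0$. Then the coefficient of $n^{d-1}$ in $Q_d$ equals $\dfrac{2^{d-1}}{(d-1)!}$.
   Context: For integers $d\ge 1$ and $n\ge 0$, let $e_1,\dots,e_d$ be the standard unit vectors of $\mathbb{Z}^d$ and let $P_n^d=\{X_1+X_2+\cdots+X_n : X_i\in\{\pm e_1,\dots,\pm e_d\}\text{ for } i=1,\dots,n\}\subseteq\mathbb{Z}^d$ be the set of possible positions of a nearest-neighbour walk in $\mathbb{Z}^d$ starting at the origin after exactly $n$ unit steps (so $P_0^d=\{0\}$). $|P_n^d|$ denotes its cardinality. For each $d$, $n\mapsto|P_n^d|$ agrees on all $n\ge0$ with a (unique) polynomial in $n$ of degree $d$. -}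

module Defs where

open import Data.Nat using (ℕ; zero; suc; _^_; _!)
open import Data.Nat.Properties using (_!≢0)
open import Data.Integer as ℤ using (ℤ; +_; -_)
open import Data.Rational as ℚ using (ℚ)
open import Data.Fin using (Fin)
open import Data.Fin.Properties using () renaming (_≟_ to _≟ᶠ_)
open import Data.Bool using (Bool; true; false; if_then_else_)
open import Data.List as List using (List; []; _∷_; length; deduplicate; allFin; cartesianProduct; concatMap)
open import Data.Vec as Vec using (Vec; []; _∷_; tabulate; zipWith; replicate)
open import Data.Vec.Properties using (≡-dec)
open import Relation.Nullary.Decidable using (does)

Point : ℕ → Set
Point d = Vec ℤ d

unitVec : {d : ℕ} → Fin d → Point d
unitVec i = tabulate (λ j → if does (i ≟ᶠ j) then + 1 else + 0)

open import Data.Product using (_×_; _,_)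

Step : ℕ → Set
Step d = Fin d × Bool

stepVec : {d : ℕ} → Step d → Point d
stepVec (i , true)  = unitVec i
stepVec (i , false) = Vec.map -_ (unitVec i)

allSteps : (d : ℕ) → List (Step d)
allSteps d = cartesianProduct (allFin d) (true ∷ false ∷ [])

allSeqs : {A : Set} → (n : ℕ) → List A → List (Vec A n)
allSeqs zero    xs = [] ∷ []
allSeqs (suc n) xs = concatMap (λ x → List.map (x ∷_) (allSeqs n xs)) xs

endpoint : {d n : ℕ} → Vec (Step d) n → Point d
endpoint {d} = Vec.foldr _ (λ s acc → zipWith ℤ._+_ (stepVec s) acc) (replicate d (+ 0))

Pset : (d n : ℕ) → List (Point d)
Pset d n = deduplicate (≡-dec ℤ._≟_) (List.map endpoint (allSeqs n (allSteps d)))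

cardP : (d n : ℕ) → ℕ
cardP d n = length (Pset d n)

-- polynomials with rational coefficients as coefficient lists [a_0, a_1, …]
Poly : Set
Poly = List ℚ

eval : Poly → ℚ → ℚ
eval []       x = ℚ.0ℚ
eval (a ∷ as) x = a ℚ.+ x ℚ.* eval as x

coeff : Poly → ℕ → ℚ
coeff []       k       = ℚ.0ℚ
coeff (a ∷ as) zero    = a
coeff (a ∷ as) (suc k) = coeff as k

twoPowOverFact : ℕ → ℚ
twoPowOverFact k = ℚ._/_ (+ (2 ^ k)) (k !) {{k !≢0}}

-- For d = e + 1 ≥ 1, a point z ∈ ℤ^d is the endpoint of an n-step walk iff
-- ‖z‖₁ ≤ n and n − ‖z‖₁ is even: walk straight to z, then spend the surplus on
-- back-and-forth steps along e₁. Sorting these points by their first coordinate t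
-- (|t| ≤ n) gives c_{d+1}(n) = c_d(n) + 2 Σ_{k<n} c_d(k), and the hockey-stick
-- identity turns this into c_{e+1}(n) = Σ_j b(e,j) (n choose j), where
-- b(e,e+1) = 2^e and 2 b(e,e) = (e+2) 2^e. As a polynomial in n, (n choose j) has
-- leading coefficient 1/j! and (n choose j+1) has n^j-coefficient −j/(2·j!), so the
-- n^e-coefficient of c_{e+1} is (b(e,e) − e 2^(e−1))/e! = 2^e/e!. A rational
-- polynomial is determined by its values on ℕ, so Q has the same coefficient.

module Submission where

open import Defs

module BinomialSums where
  open import Data.Nat using (ℕ; zero; suc; _+_; _*_; _^_; _∸_; _≤_; s≤s)
  open import Data.Nat.Properties
  open import Data.Nat.Combinatorics using (_C_; nCk+nC[k+1]≡[n+1]C[k+1]; nC1≡n)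
  open import Data.Nat.Tactic.RingSolver using (solve-∀)
  open import Relation.Binary.PropositionalEquality

  ∑< : ℕ → (ℕ → ℕ) → ℕ
  ∑< zero    f = 0
  ∑< (suc n) f = ∑< n f + f n

  infix 5 ∑<
  syntax ∑< n (λ k → e) = ∑[ k < n ] e

  ∑-cong : ∀ n {f g : ℕ → ℕ} → (∀ k → f k ≡ g k) → ∑< n f ≡ ∑< n g
  ∑-cong zero    f≗g = refl
  ∑-cong (suc n) f≗g = cong₂ _+_ (∑-cong n f≗g) (f≗g n)

  ∑-distrib-+ : ∀ n (f g : ℕ → ℕ) → ∑[ k < n ] (f k + g k) ≡ ∑< n f + ∑< n g
  ∑-distrib-+ zero    f g = refl
  ∑-distrib-+ (suc n) f g rewrite ∑-distrib-+ n f g = +-+-interchange (∑< n f) (∑< n g) (f n) (g n)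
    where
    +-+-interchange : ∀ a b c d → a + b + (c + d) ≡ a + c + (b + d)
    +-+-interchange = solve-∀

  ∑-distribˡ-* : ∀ n c (f : ℕ → ℕ) → ∑[ k < n ] c * f k ≡ c * ∑< n f
  ∑-distribˡ-* zero    c f = sym (*-zeroʳ c)
  ∑-distribˡ-* (suc n) c f rewrite ∑-distribˡ-* n c f = sym (*-distribˡ-+ c (∑< n f) (f n))

  ∑-comm : ∀ m n (f : ℕ → ℕ → ℕ) → ∑[ i < m ] ∑[ j < n ] f i j ≡ ∑[ j < n ] ∑[ i < m ] f i j
  ∑-comm m zero    f = ∑-zero m
    where
    ∑-zero : ∀ m → ∑[ i < m ] 0 ≡ 0
    ∑-zero zero    = refl
    ∑-zero (suc m) = trans (+-identityʳ _) (∑-zero m)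
  ∑-comm m (suc n) f rewrite sym (∑-comm m n f) = ∑-distrib-+ m (λ i → ∑[ j < n ] f i j) (λ i → f i n)

  ∑-peelˡ : ∀ n (f : ℕ → ℕ) → ∑< (suc n) f ≡ f 0 + (∑[ k < n ] f (suc k))
  ∑-peelˡ zero    f = +-comm 0 (f 0)
  ∑-peelˡ (suc n) f rewrite ∑-peelˡ n f = +-assoc (f 0) _ _

  ∑-reverse : ∀ n (f : ℕ → ℕ) → ∑[ k < n ] f (n ∸ suc k) ≡ ∑< n f
  ∑-reverse zero    f = refl
  ∑-reverse (suc n) f = begin
    ∑[ k < suc n ] f (n ∸ k)         ≡⟨ ∑-peelˡ n (λ k → f (n ∸ k)) ⟩
    f n + (∑[ k < n ] f (n ∸ suc k)) ≡⟨ cong (f n +_) (∑-reverse n f) ⟩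
    f n + ∑< n f                     ≡⟨ +-comm (f n) _ ⟩
    ∑< (suc n) f                     ∎
    where open ≡-Reasoning

  ∑-hockeyStick : ∀ j n → ∑[ k < n ] k C j ≡ n C suc j
  ∑-hockeyStick j zero    = refl
  ∑-hockeyStick j (suc n) rewrite ∑-hockeyStick j n =
    trans (+-comm (n C suc j) (n C j)) (nCk+nC[k+1]≡[n+1]C[k+1] n j)

  n*nCk≡[1+k]*nC[1+k]+k*nCk : ∀ n k → n * (n C k) ≡ suc k * (n C suc k) + k * (n C k)
  n*nCk≡[1+k]*nC[1+k]+k*nCk zero    zero    = refl
  n*nCk≡[1+k]*nC[1+k]+k*nCk zero    (suc k) = sym (cong₂ _+_ (*-zeroʳ (2 + k)) (*-zeroʳ (suc k)))
  n*nCk≡[1+k]*nC[1+k]+k*nCk (suc n) zero    = trans (*-identityʳ (suc n)) (sym (trans (+-identityʳ _) (trans (+-identityʳ _) (nC1≡n (suc n)))))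
  n*nCk≡[1+k]*nC[1+k]+k*nCk (suc n) (suc k) = begin
    suc n * (suc n C suc k)                                       ≡⟨ cong (suc n *_) (sym (nCk+nC[k+1]≡[n+1]C[k+1] n k)) ⟩
    suc n * (x + y)                                               ≡⟨ expand n x y ⟩
    n * x + n * y + (x + y)                                       ≡⟨ cong₂ (λ u v → u + v + (x + y)) (n*nCk≡[1+k]*nC[1+k]+k*nCk n k) (n*nCk≡[1+k]*nC[1+k]+k*nCk n (suc k)) ⟩
    suc k * y + k * x + ((2 + k) * z + suc k * y) + (x + y)        ≡⟨ collect k x y z ⟩
    (2 + k) * (y + z) + suc k * (x + y)                           ≡⟨ cong₂ (λ u v → (2 + k) * u + suc k * v) (nCk+nC[k+1]≡[n+1]C[k+1] n (suc k)) (nCk+nC[k+1]≡[n+1]C[k+1] n k) ⟩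
    (2 + k) * (suc n C (2 + k)) + suc k * (suc n C suc k)         ∎
    where
    open ≡-Reasoning
    x = n C k
    y = n C suc k
    z = n C (2 + k)
    expand : ∀ n x y → suc n * (x + y) ≡ n * x + n * y + (x + y)
    expand = solve-∀
    collect : ∀ k x y z → suc k * y + k * x + ((2 + k) * z + suc k * y) + (x + y) ≡ (2 + k) * (y + z) + suc k * (x + y)
    collect = solve-∀

  -- countCoeff e j is the coefficient of x^j in (1 + x) (1 + 2x)^e.
  countCoeff : ℕ → ℕ → ℕ
  countCoeff zero    zero          = 1
  countCoeff zero    (suc zero)    = 1
  countCoeff zero    (suc (suc j)) = 0
  countCoeff (suc e) zero          = countCoeff e zero
  countCoeff (suc e) (suc j)       = countCoeff e (suc j) + 2 * countCoeff e j

  countCoeff-high : ∀ e j → 2 + e ≤ j → countCoeff e j ≡ 0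
  countCoeff-high zero    (suc zero)    (s≤s ())
  countCoeff-high zero    (suc (suc j)) _         = refl
  countCoeff-high (suc e) (suc j)       (s≤s e<j)
    rewrite countCoeff-high e (suc j) (m≤n⇒m≤1+n e<j) | countCoeff-high e j e<j = refl

  countCoeff-top : ∀ e → countCoeff e (suc e) ≡ 2 ^ e
  countCoeff-top zero    = refl
  countCoeff-top (suc e) rewrite countCoeff-high e (2 + e) ≤-refl | countCoeff-top e = refl

  countCoeff-diag : ∀ e → 2 * countCoeff e e ≡ (e + 2) * 2 ^ e
  countCoeff-diag zero    = refl
  countCoeff-diag (suc e) = begin
    2 * (countCoeff e (suc e) + 2 * countCoeff e e) ≡⟨ cong₂ (λ u v → 2 * (u + v)) (countCoeff-top e) (countCoeff-diag e) ⟩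
    2 * (2 ^ e + (e + 2) * 2 ^ e)                   ≡⟨ collect e (2 ^ e) ⟩
    (suc e + 2) * 2 ^ suc e                         ∎
    where
    open ≡-Reasoning
    collect : ∀ e p → 2 * (p + (e + 2) * p) ≡ (suc e + 2) * (2 * p)
    collect = solve-∀

  countExpansion : ℕ → ℕ → ℕ
  countExpansion e n = ∑[ j < 2 + e ] countCoeff e j * (n C j)

  countExpansion-zero : ∀ n → countExpansion 0 n ≡ suc n
  countExpansion-zero n = cong suc (trans (+-identityʳ (n C 1)) (nC1≡n n))

  countExpansion-suc : ∀ e n → countExpansion (suc e) n ≡ countExpansion e n + 2 * (∑[ k < n ] countExpansion e k)
  countExpansion-suc e n = begin
    countExpansion (suc e) n
      ≡⟨ ∑-peelˡ m (λ j → countCoeff (suc e) j * (n C j)) ⟩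
    b 0 * 1 + (∑[ j < m ] (b (suc j) + 2 * b j) * (n C suc j))
      ≡⟨ cong (b 0 * 1 +_) (trans (∑-cong m (λ j → *-distribʳ-+ (n C suc j) (b (suc j)) (2 * b j)))
                                  (∑-distrib-+ m (λ j → b (suc j) * (n C suc j)) (λ j → 2 * b j * (n C suc j)))) ⟩
    b 0 * 1 + ((∑[ j < m ] b (suc j) * (n C suc j)) + (∑[ j < m ] 2 * b j * (n C suc j)))
      ≡⟨ sym (+-assoc (b 0 * 1) _ _) ⟩
    b 0 * 1 + (∑[ j < m ] b (suc j) * (n C suc j)) + (∑[ j < m ] 2 * b j * (n C suc j))
      ≡⟨ cong₂ _+_ (sym (∑-peelˡ m (λ j → b j * (n C j)))) (trans (∑-cong m (λ j → *-assoc 2 (b j) (n C suc j))) (∑-distribˡ-* m 2 _)) ⟩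
    countExpansion e n + b m * (n C m) + 2 * (∑[ j < m ] b j * (n C suc j))
      ≡⟨ cong₂ (λ u v → countExpansion e n + u * (n C m) + 2 * v) (countCoeff-high e m ≤-refl) (sym ∑countExpansion) ⟩
    countExpansion e n + 0 + 2 * (∑[ k < n ] countExpansion e k)
      ≡⟨ cong (_+ 2 * (∑[ k < n ] countExpansion e k)) (+-identityʳ (countExpansion e n)) ⟩
    countExpansion e n + 2 * (∑[ k < n ] countExpansion e k)
      ∎
    where
    open ≡-Reasoning
    m = 2 + e
    b = countCoeff e
    ∑countExpansion : ∑[ k < n ] countExpansion e k ≡ ∑[ j < m ] b j * (n C suc j)
    ∑countExpansion = begin
      ∑[ k < n ] ∑[ j < m ] b j * (k C j)   ≡⟨ ∑-comm n m (λ k j → b j * (k C j)) ⟩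
      ∑[ j < m ] ∑[ k < n ] b j * (k C j)   ≡⟨ ∑-cong m (λ j → ∑-distribˡ-* n (b j) (λ k → k C j)) ⟩
      ∑[ j < m ] b j * (∑[ k < n ] k C j)   ≡⟨ ∑-cong m (λ j → cong (b j *_) (∑-hockeyStick j n)) ⟩
      ∑[ j < m ] b j * (n C suc j)          ∎

module RationalPolynomials where
  open BinomialSums using (∑<; n*nCk≡[1+k]*nC[1+k]+k*nCk)
  open import Data.Nat as ℕ using (ℕ; zero; suc; _≤_; _<_; s≤s; _!)
  open import Data.Nat.Combinatorics using (_C_)
  import Data.Nat.Properties as ℕ
  open import Data.Nat.Coprimality using (1-coprimeTo) renaming (sym to coprime-sym)
  open import Data.Integer as ℤ using (+_)
  import Data.Integer.Properties as ℤ
  open import Data.Rational as ℚ using (ℚ; _/_; mkℚ; 0ℚ; 1ℚ; _+_; _*_; _-_; -_; 1/_)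
  import Data.Rational.Properties as ℚ
  import Data.Rational.Unnormalised as ℚᵘ
  import Data.Rational.Unnormalised.Properties as ℚᵘ
  open import Data.Rational.Solver using (module +-*-Solver)
  open +-*-Solver using (solve; _:=_; _:+_; _:*_; _:-_; :-_; con)
  open import Algebra.Properties.Group ℚ.+-0-group using (x∙y⁻¹≈ε⇒x≈y)
  open import Data.List using ([]; _∷_; length)
  open import Function using (_∘_)
  open import Relation.Binary.PropositionalEquality

  toℚ : ℕ → ℚ
  toℚ n = + n / 1

  toℚ≡mkℚ : ∀ n → toℚ n ≡ mkℚ (+ n) 0 (coprime-sym (1-coprimeTo n))
  toℚ≡mkℚ n = ℚ.normalize-coprime (coprime-sym (1-coprimeTo n))

  toℚ-injective : ∀ {m n} → toℚ m ≡ toℚ n → m ≡ n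
  toℚ-injective {m} {n} eq = ℤ.+-injective (cong ℚ.↥_ (trans (sym (toℚ≡mkℚ m)) (trans eq (toℚ≡mkℚ n))))

  toℚ-+ : ∀ m n → toℚ (m ℕ.+ n) ≡ toℚ m + toℚ n
  toℚ-+ m n rewrite toℚ≡mkℚ m | toℚ≡mkℚ n =
    ℚ./-cong (trans (ℤ.pos-+ m n) (sym (cong₂ ℤ._+_ (ℤ.*-identityʳ (+ m)) (ℤ.*-identityʳ (+ n))))) refl

  toℚ-* : ∀ m n → toℚ (m ℕ.* n) ≡ toℚ m * toℚ n
  toℚ-* m n rewrite toℚ≡mkℚ m | toℚ≡mkℚ n = ℚ./-cong (ℤ.pos-* m n) refl

  toℚ-*-/ : ∀ m k .{{_ : ℕ.NonZero k}} → toℚ k * (+ m / k) ≡ toℚ m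
  toℚ-*-/ m k@(suc k-1) = ℚ.toℚᵘ-injective (begin
    ℚ.toℚᵘ (toℚ k * (+ m / k))                             ≈⟨ ℚ.toℚᵘ-homo-* (toℚ k) (+ m / k) ⟩
    ℚ.toℚᵘ (toℚ k) ℚᵘ.* ℚ.toℚᵘ (+ m / k)                   ≈⟨ ℚᵘ.*-cong (ℚ.toℚᵘ-fromℚᵘ (ℚᵘ.mkℚᵘ (+ k) 0)) (ℚ.toℚᵘ-fromℚᵘ (ℚᵘ.mkℚᵘ (+ m) (ℕ.pred k))) ⟩
    ℚᵘ.mkℚᵘ (+ k) 0 ℚᵘ.* ℚᵘ.mkℚᵘ (+ m) (ℕ.pred k)          ≈⟨ ℚᵘ.*≡* k*m≡m*k ⟩
    ℚᵘ.mkℚᵘ (+ m) 0                                        ≈⟨ ℚᵘ.≃-sym (ℚ.toℚᵘ-fromℚᵘ (ℚᵘ.mkℚᵘ (+ m) 0)) ⟩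
    ℚ.toℚᵘ (toℚ m)                                         ∎)
    where
    open ℚᵘ.≃-Reasoning
    k*m≡m*k = trans (ℤ.*-identityʳ _) (trans (ℤ.*-comm (+ k) (+ m)) (cong (λ j → + m ℤ.* + j) (sym (ℕ.+-identityʳ k))))

  toℚ-suc≢0 : ∀ n → toℚ (suc n) ≢ 0ℚ
  toℚ-suc≢0 n eq = ℕ.1+n≢0 (toℚ-injective {suc n} {0} eq)

  *-cancelˡ : ∀ {x y z} → x ≢ 0ℚ → x * y ≡ x * z → y ≡ z
  *-cancelˡ {x} {y} {z} x≢0 xy≡xz = begin
    y              ≡⟨ sym (ℚ.*-identityˡ y) ⟩
    1ℚ * y         ≡⟨ cong (_* y) (sym (ℚ.*-inverseˡ x)) ⟩
    1/ x * x * y   ≡⟨ ℚ.*-assoc (1/ x) x y ⟩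
    1/ x * (x * y) ≡⟨ cong (1/ x *_) xy≡xz ⟩
    1/ x * (x * z) ≡⟨ sym (ℚ.*-assoc (1/ x) x z) ⟩
    1/ x * x * z   ≡⟨ cong (_* z) (ℚ.*-inverseˡ x) ⟩
    1ℚ * z         ≡⟨ ℚ.*-identityˡ z ⟩
    z              ∎
    where
    open ≡-Reasoning
    instance _ = ℚ.≢-nonZero x≢0

  toℚ-*-cancel : ∀ m k .{{_ : ℕ.NonZero k}} {x} → toℚ k * x ≡ toℚ m → x ≡ + m / k
  toℚ-*-cancel m k@(suc k-1) kx≡m = *-cancelˡ (toℚ-suc≢0 k-1) (trans kx≡m (sym (toℚ-*-/ m k)))

  infixl 6 _+ₚ_ _-ₚ_
  infixr 7 _·ₚ_

  _+ₚ_ : Poly → Poly → Poly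
  []      +ₚ q       = q
  (a ∷ p) +ₚ []      = a ∷ p
  (a ∷ p) +ₚ (b ∷ q) = a + b ∷ p +ₚ q

  _·ₚ_ : ℚ → Poly → Poly
  c ·ₚ []      = []
  c ·ₚ (a ∷ p) = c * a ∷ c ·ₚ p

  _-ₚ_ : Poly → Poly → Poly
  p -ₚ q = p +ₚ (- 1ℚ) ·ₚ q

  mulX+ : ℚ → Poly → Poly
  mulX+ c p = c ·ₚ p +ₚ (0ℚ ∷ p)

  eval-+ₚ : ∀ p q x → eval (p +ₚ q) x ≡ eval p x + eval q x
  eval-+ₚ []      q       x = sym (ℚ.+-identityˡ _)
  eval-+ₚ (a ∷ p) []      x = sym (ℚ.+-identityʳ _)
  eval-+ₚ (a ∷ p) (b ∷ q) x rewrite eval-+ₚ p q x = shuffle a b x (eval p x) (eval q x)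
    where
    shuffle : ∀ a b x u v → a + b + x * (u + v) ≡ a + x * u + (b + x * v)
    shuffle = solve 5 (λ a b x u v → a :+ b :+ x :* (u :+ v) := a :+ x :* u :+ (b :+ x :* v)) refl

  coeff-+ₚ : ∀ p q k → coeff (p +ₚ q) k ≡ coeff p k + coeff q k
  coeff-+ₚ []      q       k       = sym (ℚ.+-identityˡ _)
  coeff-+ₚ (a ∷ p) []      zero    = sym (ℚ.+-identityʳ _)
  coeff-+ₚ (a ∷ p) []      (suc k) = sym (ℚ.+-identityʳ _)
  coeff-+ₚ (a ∷ p) (b ∷ q) zero    = refl
  coeff-+ₚ (a ∷ p) (b ∷ q) (suc k) = coeff-+ₚ p q k

  eval-·ₚ : ∀ c p x → eval (c ·ₚ p) x ≡ c * eval p x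
  eval-·ₚ c []      x = sym (ℚ.*-zeroʳ c)
  eval-·ₚ c (a ∷ p) x rewrite eval-·ₚ c p x = shuffle c a x (eval p x)
    where
    shuffle : ∀ c a x u → c * a + x * (c * u) ≡ c * (a + x * u)
    shuffle = solve 4 (λ c a x u → c :* a :+ x :* (c :* u) := c :* (a :+ x :* u)) refl

  coeff-·ₚ : ∀ c p k → coeff (c ·ₚ p) k ≡ c * coeff p k
  coeff-·ₚ c []      k       = sym (ℚ.*-zeroʳ c)
  coeff-·ₚ c (a ∷ p) zero    = refl
  coeff-·ₚ c (a ∷ p) (suc k) = coeff-·ₚ c p k

  eval-mulX+ : ∀ c p x → eval (mulX+ c p) x ≡ (x + c) * eval p x
  eval-mulX+ c p x rewrite eval-+ₚ (c ·ₚ p) (0ℚ ∷ p) x | eval-·ₚ c p x = shuffle c x (eval p x)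
    where
    shuffle : ∀ c x u → c * u + (0ℚ + x * u) ≡ (x + c) * u
    shuffle = solve 3 (λ c x u → c :* u :+ (con 0ℚ :+ x :* u) := (x :+ c) :* u) refl

  coeff-mulX+ : ∀ c p k → coeff (mulX+ c p) (suc k) ≡ c * coeff p (suc k) + coeff p k
  coeff-mulX+ c p k = trans (coeff-+ₚ (c ·ₚ p) (0ℚ ∷ p) (suc k)) (cong (_+ coeff p k) (coeff-·ₚ c p (suc k)))

  remainder : ℚ → ℚ → Poly → ℚ
  remainder c a []       = a
  remainder c a (b ∷ bs) = a + c * remainder c b bs

  quotient : ℚ → ℚ → Poly → Poly
  quotient c a []       = []
  quotient c a (b ∷ bs) = remainder c b bs ∷ quotient c b bs

  eval-quotient : ∀ c a as x → eval (a ∷ as) x ≡ (x - c) * eval (quotient c a as) x + remainder c a as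
  eval-quotient c a []       x = shuffle a x c
    where
    shuffle : ∀ a x c → a + x * 0ℚ ≡ (x - c) * 0ℚ + a
    shuffle = solve 3 (λ a x c → a :+ x :* con 0ℚ := (x :- c) :* con 0ℚ :+ a) refl
  eval-quotient c a (b ∷ bs) x rewrite eval-quotient c b bs x =
    shuffle a x c (eval (quotient c b bs) x) (remainder c b bs)
    where
    shuffle : ∀ a x c q r → a + x * ((x - c) * q + r) ≡ (x - c) * (r + x * q) + (a + c * r)
    shuffle = solve 5 (λ a x c q r → a :+ x :* ((x :- c) :* q :+ r) := (x :- c) :* (r :+ x :* q) :+ (a :+ c :* r)) refl

  remainder≡eval : ∀ c a as → remainder c a as ≡ eval (a ∷ as) c
  remainder≡eval c a []       = sym (trans (cong (_+_ a) (ℚ.*-zeroʳ c)) (ℚ.+-identityʳ a))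
  remainder≡eval c a (b ∷ bs) = cong (λ r → a + c * r) (remainder≡eval c b bs)

  length-quotient : ∀ c a as → length (quotient c a as) ≡ length as
  length-quotient c a []       = refl
  length-quotient c a (b ∷ bs) = cong suc (length-quotient c b bs)

  IsZero : Poly → Set
  IsZero p = ∀ k → coeff p k ≡ 0ℚ

  quotient-isZero⇒isZero : ∀ c a as → IsZero (quotient c a as) → remainder c a as ≡ 0ℚ → IsZero (a ∷ as)
  quotient-isZero⇒isZero c a []       q≡0 r≡0 zero    = r≡0
  quotient-isZero⇒isZero c a []       q≡0 r≡0 (suc k) = refl
  quotient-isZero⇒isZero c a (b ∷ bs) q≡0 r≡0 zero    = begin
    a                    ≡⟨ sym (trans (cong (_+_ a) (ℚ.*-zeroʳ c)) (ℚ.+-identityʳ a)) ⟩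
    a + c * 0ℚ           ≡⟨ cong (λ r → a + c * r) (sym (q≡0 zero)) ⟩
    a + c * remainder c b bs ≡⟨ r≡0 ⟩
    0ℚ                   ∎
    where open ≡-Reasoning
  quotient-isZero⇒isZero c a (b ∷ bs) q≡0 r≡0 (suc k) = quotient-isZero⇒isZero c b bs (q≡0 ∘ suc) (q≡0 zero) k

  VanishesFrom : ℕ → Poly → Set
  VanishesFrom N p = ∀ n → N ≤ n → eval p (toℚ n) ≡ 0ℚ

  remainder-vanishes : ∀ N a as → VanishesFrom N (a ∷ as) → remainder (toℚ N) a as ≡ 0ℚ
  remainder-vanishes N a as v = trans (remainder≡eval (toℚ N) a as) (v N ℕ.≤-refl)

  quotient-vanishes : ∀ N a as → VanishesFrom N (a ∷ as) → VanishesFrom (suc N) (quotient (toℚ N) a as)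
  quotient-vanishes N a as v n N<n = *-cancelˡ n-N≢0 (begin
    (toℚ n - c) * eval q (toℚ n)                    ≡⟨ sym (ℚ.+-identityʳ ((toℚ n - c) * eval q (toℚ n))) ⟩
    (toℚ n - c) * eval q (toℚ n) + 0ℚ               ≡⟨ cong (_+_ ((toℚ n - c) * eval q (toℚ n))) (sym (remainder-vanishes N a as v)) ⟩
    (toℚ n - c) * eval q (toℚ n) + remainder c a as ≡⟨ sym (eval-quotient c a as (toℚ n)) ⟩
    eval (a ∷ as) (toℚ n)                           ≡⟨ v n (ℕ.<⇒≤ N<n) ⟩
    0ℚ                                              ≡⟨ sym (ℚ.*-zeroʳ (toℚ n - c)) ⟩
    (toℚ n - c) * 0ℚ                                ∎)
    where
    open ≡-Reasoning
    c = toℚ N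
    q = quotient c a as
    n-N≢0 : toℚ n - c ≢ 0ℚ
    n-N≢0 eq = ℕ.<⇒≢ N<n (sym (toℚ-injective (x∙y⁻¹≈ε⇒x≈y (toℚ n) c eq)))

  vanishesFrom⇒isZero : ∀ N p → VanishesFrom N p → IsZero p
  vanishesFrom⇒isZero N []       v k = refl
  vanishesFrom⇒isZero N (a ∷ as) v   = go (length as) N a as refl v
    where
    -- The quotient is not a structural subterm of a ∷ as, so recurse on its length.
    go : ∀ L N a as → length as ≡ L → VanishesFrom N (a ∷ as) → IsZero (a ∷ as)
    go L       N a []       _   v = quotient-isZero⇒isZero (toℚ N) a [] (λ _ → refl) (remainder-vanishes N a [] v)
    go (suc L) N a (b ∷ bs) len v = quotient-isZero⇒isZero (toℚ N) a (b ∷ bs)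
      (go L (suc N) _ _ (trans (length-quotient (toℚ N) b bs) (ℕ.suc-injective len)) (quotient-vanishes N a (b ∷ bs) v))
      (remainder-vanishes N a (b ∷ bs) v)

  coeff-unique : ∀ p q → (∀ n → eval p (toℚ n) ≡ eval q (toℚ n)) → ∀ k → coeff p k ≡ coeff q k
  coeff-unique p q p≗q k = x∙y⁻¹≈ε⇒x≈y (coeff p k) (coeff q k) (begin
    coeff p k - coeff q k         ≡⟨ cong (_+_ (coeff p k)) (trans (cong -_ (sym (ℚ.*-identityˡ (coeff q k)))) (ℚ.neg-distribˡ-* 1ℚ (coeff q k))) ⟩
    coeff p k + - 1ℚ * coeff q k  ≡⟨ cong (_+_ (coeff p k)) (sym (coeff-·ₚ (- 1ℚ) q k)) ⟩
    coeff p k + coeff (- 1ℚ ·ₚ q) k ≡⟨ sym (coeff-+ₚ p _ k) ⟩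
    coeff (p -ₚ q) k              ≡⟨ vanishesFrom⇒isZero 0 (p -ₚ q) difference-vanishes k ⟩
    0ℚ                            ∎)
    where
    open ≡-Reasoning
    difference-vanishes : VanishesFrom 0 (p -ₚ q)
    difference-vanishes n _ = begin
      eval (p -ₚ q) (toℚ n)                          ≡⟨ eval-+ₚ p _ (toℚ n) ⟩
      eval p (toℚ n) + eval (- 1ℚ ·ₚ q) (toℚ n)      ≡⟨ cong (_+_ (eval p (toℚ n))) (eval-·ₚ (- 1ℚ) q (toℚ n)) ⟩
      eval p (toℚ n) + - 1ℚ * eval q (toℚ n)         ≡⟨ cong (λ y → eval p (toℚ n) + - 1ℚ * y) (sym (p≗q n)) ⟩
      eval p (toℚ n) + - 1ℚ * eval p (toℚ n)         ≡⟨ cancel (eval p (toℚ n)) ⟩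
      0ℚ                                             ∎
      where
      cancel : ∀ y → y + - 1ℚ * y ≡ 0ℚ
      cancel = solve 1 (λ y → y :+ :- con 1ℚ :* y := con 0ℚ) refl

  choosePoly : ℕ → Poly
  choosePoly zero    = 1ℚ ∷ []
  choosePoly (suc j) = (+ 1 / suc j) ·ₚ mulX+ (- toℚ j) (choosePoly j)

  toℚ-suc-*-choosePoly : ∀ j (f : Poly → ℚ) → (∀ c p → f (c ·ₚ p) ≡ c * f p) →
                         toℚ (suc j) * f (choosePoly (suc j)) ≡ f (mulX+ (- toℚ j) (choosePoly j))
  toℚ-suc-*-choosePoly j f f-·ₚ = begin
    toℚ (suc j) * f (choosePoly (suc j))    ≡⟨ cong (toℚ (suc j) *_) (f-·ₚ (+ 1 / suc j) p) ⟩
    toℚ (suc j) * ((+ 1 / suc j) * f p)     ≡⟨ sym (ℚ.*-assoc (toℚ (suc j)) (+ 1 / suc j) (f p)) ⟩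
    toℚ (suc j) * (+ 1 / suc j) * f p       ≡⟨ cong (_* f p) (toℚ-*-/ 1 (suc j)) ⟩
    1ℚ * f p                                ≡⟨ ℚ.*-identityˡ (f p) ⟩
    f p                                     ∎
    where
    open ≡-Reasoning
    p = mulX+ (- toℚ j) (choosePoly j)

  eval-choosePoly : ∀ j n → eval (choosePoly j) (toℚ n) ≡ toℚ (n C j)
  eval-choosePoly zero    n = trans (cong (_+_ 1ℚ) (ℚ.*-zeroʳ (toℚ n))) (ℚ.+-identityʳ 1ℚ)
  eval-choosePoly (suc j) n = *-cancelˡ (toℚ-suc≢0 j) (begin
    toℚ (suc j) * eval (choosePoly (suc j)) (toℚ n)  ≡⟨ toℚ-suc-*-choosePoly j (λ p → eval p (toℚ n)) (λ c p → eval-·ₚ c p (toℚ n)) ⟩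
    eval (mulX+ (- toℚ j) (choosePoly j)) (toℚ n)    ≡⟨ eval-mulX+ (- toℚ j) (choosePoly j) (toℚ n) ⟩
    (toℚ n - toℚ j) * eval (choosePoly j) (toℚ n)    ≡⟨ cong ((toℚ n - toℚ j) *_) (eval-choosePoly j n) ⟩
    (toℚ n - toℚ j) * B                              ≡⟨ distrib (toℚ n) (toℚ j) B ⟩
    toℚ n * B - toℚ j * B                            ≡⟨ cong (_- toℚ j * B) absorption ⟩
    toℚ (suc j) * B′ + toℚ j * B - toℚ j * B         ≡⟨ cancel (toℚ (suc j) * B′) (toℚ j * B) ⟩
    toℚ (suc j) * B′                                 ∎)
    where
    open ≡-Reasoning
    B  = toℚ (n C j)
    B′ = toℚ (n C suc j)
    absorption : toℚ n * B ≡ toℚ (suc j) * B′ + toℚ j * B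
    absorption = begin
      toℚ n * B                                             ≡⟨ sym (toℚ-* n (n C j)) ⟩
      toℚ (n ℕ.* (n C j))                                   ≡⟨ cong toℚ (n*nCk≡[1+k]*nC[1+k]+k*nCk n j) ⟩
      toℚ (suc j ℕ.* (n C suc j) ℕ.+ j ℕ.* (n C j))         ≡⟨ toℚ-+ (suc j ℕ.* (n C suc j)) (j ℕ.* (n C j)) ⟩
      toℚ (suc j ℕ.* (n C suc j)) + toℚ (j ℕ.* (n C j))     ≡⟨ cong₂ _+_ (toℚ-* (suc j) (n C suc j)) (toℚ-* j (n C j)) ⟩
      toℚ (suc j) * B′ + toℚ j * B                          ∎
    distrib : ∀ x y z → (x + - y) * z ≡ x * z - y * z
    distrib = solve 3 (λ x y z → (x :+ :- y) :* z := x :* z :- y :* z) refl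
    cancel : ∀ x y → x + y - y ≡ x
    cancel = solve 2 (λ x y → x :+ y :- y := x) refl

  coeff-choosePoly-suc : ∀ j k → toℚ (suc j) * coeff (choosePoly (suc j)) (suc k) ≡
                                 - toℚ j * coeff (choosePoly j) (suc k) + coeff (choosePoly j) k
  coeff-choosePoly-suc j k = trans (toℚ-suc-*-choosePoly j (λ p → coeff p (suc k)) (λ c p → coeff-·ₚ c p (suc k)))
                                   (coeff-mulX+ (- toℚ j) (choosePoly j) k)

  coeff-choosePoly-high : ∀ j k → j < k → coeff (choosePoly j) k ≡ 0ℚ
  coeff-choosePoly-high zero    (suc k) _         = refl
  coeff-choosePoly-high (suc j) (suc k) (s≤s j<k) = *-cancelˡ (toℚ-suc≢0 j) (begin
    toℚ (suc j) * coeff (choosePoly (suc j)) (suc k)                    ≡⟨ coeff-choosePoly-suc j k ⟩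
    - toℚ j * coeff (choosePoly j) (suc k) + coeff (choosePoly j) k     ≡⟨ cong₂ (λ u v → - toℚ j * u + v) (coeff-choosePoly-high j (suc k) (ℕ.m≤n⇒m≤1+n j<k)) (coeff-choosePoly-high j k j<k) ⟩
    - toℚ j * 0ℚ + 0ℚ                                                   ≡⟨ zeros (toℚ j) (toℚ (suc j)) ⟩
    toℚ (suc j) * 0ℚ                                                    ∎)
    where
    open ≡-Reasoning
    zeros : ∀ x y → - x * 0ℚ + 0ℚ ≡ y * 0ℚ
    zeros = solve 2 (λ x y → :- x :* con 0ℚ :+ con 0ℚ := y :* con 0ℚ) refl

  coeff-choosePoly-leading : ∀ j → toℚ (j !) * coeff (choosePoly j) j ≡ 1ℚ
  coeff-choosePoly-leading zero    = refl
  coeff-choosePoly-leading (suc j) = begin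
    toℚ (suc j ℕ.* j !) * c                                      ≡⟨ cong (_* c) (toℚ-* (suc j) (j !)) ⟩
    toℚ (suc j) * toℚ (j !) * c                                  ≡⟨ swap (toℚ (suc j)) (toℚ (j !)) c ⟩
    toℚ (j !) * (toℚ (suc j) * c)                                ≡⟨ cong (toℚ (j !) *_) (coeff-choosePoly-suc j j) ⟩
    toℚ (j !) * (- toℚ j * coeff (choosePoly j) (suc j) + coeff (choosePoly j) j)
        ≡⟨ cong (λ u → toℚ (j !) * (- toℚ j * u + coeff (choosePoly j) j)) (coeff-choosePoly-high j (suc j) ℕ.≤-refl) ⟩
    toℚ (j !) * (- toℚ j * 0ℚ + coeff (choosePoly j) j)          ≡⟨ drop (toℚ (j !)) (toℚ j) (coeff (choosePoly j) j) ⟩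
    toℚ (j !) * coeff (choosePoly j) j                           ≡⟨ coeff-choosePoly-leading j ⟩
    1ℚ                                                           ∎
    where
    open ≡-Reasoning
    c = coeff (choosePoly (suc j)) (suc j)
    swap : ∀ x y z → x * y * z ≡ y * (x * z)
    swap = solve 3 (λ x y z → x :* y :* z := y :* (x :* z)) refl
    drop : ∀ x y z → x * (- y * 0ℚ + z) ≡ x * z
    drop = solve 3 (λ x y z → x :* (:- y :* con 0ℚ :+ z) := x :* z) refl

  coeff-choosePoly-subleading : ∀ j → toℚ 2 * toℚ (j !) * coeff (choosePoly (suc j)) j ≡ - toℚ j
  coeff-choosePoly-subleading zero    = refl
  coeff-choosePoly-subleading (suc i) = *-cancelˡ (toℚ-suc≢0 (suc i)) (begin
    toℚ (2 ℕ.+ i) * (toℚ 2 * toℚ (suc i ℕ.* i !) * s)   ≡⟨ cong (λ u → toℚ (2 ℕ.+ i) * (toℚ 2 * u * s)) (toℚ-* (suc i) (i !)) ⟩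
    toℚ (2 ℕ.+ i) * (toℚ 2 * (a * F) * s)               ≡⟨ swap (toℚ (2 ℕ.+ i)) (toℚ 2 * (a * F)) s ⟩
    toℚ 2 * (a * F) * (toℚ (2 ℕ.+ i) * s)               ≡⟨ cong (toℚ 2 * (a * F) *_) (coeff-choosePoly-suc (suc i) i) ⟩
    toℚ 2 * (a * F) * (- a * t + s′)                    ≡⟨ regroup (toℚ 2) a F t s′ ⟩
    - (toℚ 2 * a) * (a * F * t) + a * (toℚ 2 * F * s′)  ≡⟨ cong₂ (λ u v → - (toℚ 2 * a) * u + a * v) leading (coeff-choosePoly-subleading i) ⟩
    - (toℚ 2 * a) * 1ℚ + a * - toℚ i                    ≡⟨ factor (toℚ 2) (toℚ i) a ⟩
    (toℚ 2 + toℚ i) * - a                               ≡⟨ cong (_* - a) (sym (toℚ-+ 2 i)) ⟩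
    toℚ (2 ℕ.+ i) * - a                                 ∎)
    where
    open ≡-Reasoning
    a  = toℚ (suc i)
    F  = toℚ (i !)
    s  = coeff (choosePoly (2 ℕ.+ i)) (suc i)
    t  = coeff (choosePoly (suc i)) (suc i)
    s′ = coeff (choosePoly (suc i)) i
    leading : a * F * t ≡ 1ℚ
    leading = trans (cong (_* t) (sym (toℚ-* (suc i) (i !)))) (coeff-choosePoly-leading (suc i))
    swap : ∀ x y z → x * (y * z) ≡ y * (x * z)
    swap = solve 3 (λ x y z → x :* (y :* z) := y :* (x :* z)) refl
    regroup : ∀ w a F t s → w * (a * F) * (- a * t + s) ≡ - (w * a) * (a * F * t) + a * (w * F * s)
    regroup = solve 5 (λ w a F t s → w :* (a :* F) :* (:- a :* t :+ s) := :- (w :* a) :* (a :* F :* t) :+ a :* (w :* F :* s)) refl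
    factor : ∀ w i a → - (w * a) * 1ℚ + a * - i ≡ (w + i) * - a
    factor = solve 3 (λ w i a → :- (w :* a) :* con 1ℚ :+ a :* :- i := (w :+ i) :* :- a) refl

  combination : (ℕ → ℕ) → ℕ → Poly
  combination a zero    = []
  combination a (suc m) = combination a m +ₚ toℚ (a m) ·ₚ choosePoly m

  eval-combination : ∀ a m n → eval (combination a m) (toℚ n) ≡ toℚ (∑[ j < m ] a j ℕ.* (n C j))
  eval-combination a zero    n = refl
  eval-combination a (suc m) n = begin
    eval (combination a m +ₚ toℚ (a m) ·ₚ choosePoly m) (toℚ n)
      ≡⟨ eval-+ₚ (combination a m) _ (toℚ n) ⟩
    eval (combination a m) (toℚ n) + eval (toℚ (a m) ·ₚ choosePoly m) (toℚ n)
      ≡⟨ cong₂ _+_ (eval-combination a m n) (eval-·ₚ (toℚ (a m)) (choosePoly m) (toℚ n)) ⟩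
    toℚ (∑[ j < m ] a j ℕ.* (n C j)) + toℚ (a m) * eval (choosePoly m) (toℚ n)
      ≡⟨ cong (λ u → toℚ (∑[ j < m ] a j ℕ.* (n C j)) + toℚ (a m) * u) (eval-choosePoly m n) ⟩
    toℚ (∑[ j < m ] a j ℕ.* (n C j)) + toℚ (a m) * toℚ (n C m)
      ≡⟨ cong (_+_ (toℚ (∑[ j < m ] a j ℕ.* (n C j)))) (sym (toℚ-* (a m) (n C m))) ⟩
    toℚ (∑[ j < m ] a j ℕ.* (n C j)) + toℚ (a m ℕ.* (n C m))
      ≡⟨ sym (toℚ-+ (∑[ j < m ] a j ℕ.* (n C j)) (a m ℕ.* (n C m))) ⟩
    toℚ (∑[ j < suc m ] a j ℕ.* (n C j))
      ∎
    where open ≡-Reasoning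

  coeff-combination-step : ∀ a m k → coeff (combination a (suc m)) k ≡ coeff (combination a m) k + toℚ (a m) * coeff (choosePoly m) k
  coeff-combination-step a m k = trans (coeff-+ₚ (combination a m) _ k) (cong (_+_ (coeff (combination a m) k)) (coeff-·ₚ (toℚ (a m)) (choosePoly m) k))

  coeff-combination-high : ∀ a m k → m ≤ k → coeff (combination a m) k ≡ 0ℚ
  coeff-combination-high a zero    k _   = refl
  coeff-combination-high a (suc m) k m<k = begin
    coeff (combination a (suc m)) k                          ≡⟨ coeff-combination-step a m k ⟩
    coeff (combination a m) k + toℚ (a m) * coeff (choosePoly m) k
        ≡⟨ cong₂ (λ u v → u + toℚ (a m) * v) (coeff-combination-high a m k (ℕ.<⇒≤ m<k)) (coeff-choosePoly-high m k m<k) ⟩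
    0ℚ + toℚ (a m) * 0ℚ                                      ≡⟨ zeros (toℚ (a m)) ⟩
    0ℚ                                                       ∎
    where
    open ≡-Reasoning
    zeros : ∀ x → 0ℚ + x * 0ℚ ≡ 0ℚ
    zeros = solve 1 (λ x → con 0ℚ :+ x :* con 0ℚ := con 0ℚ) refl

  coeff-combination-subleading : ∀ a e → toℚ 2 * (toℚ (e !) * coeff (combination a (suc (suc e))) e) + toℚ e * toℚ (a (suc e)) ≡ toℚ 2 * toℚ (a e)
  coeff-combination-subleading a e = begin
    toℚ 2 * (F * coeff (combination a (suc (suc e))) e) + toℚ e * B
        ≡⟨ cong (λ u → toℚ 2 * (F * u) + toℚ e * B) (trans (coeff-combination-step a (suc e) e) (cong (_+ B * coeff (choosePoly (suc e)) e) (coeff-combination-step a e e))) ⟩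
    toℚ 2 * (F * (coeff (combination a e) e + A * t + B * s)) + toℚ e * B
        ≡⟨ cong (λ u → toℚ 2 * (F * (u + A * t + B * s)) + toℚ e * B) (coeff-combination-high a e e ℕ.≤-refl) ⟩
    toℚ 2 * (F * (0ℚ + A * t + B * s)) + toℚ e * B
        ≡⟨ regroup (toℚ 2) F A B t s (toℚ e) ⟩
    toℚ 2 * A * (F * t) + B * (toℚ 2 * F * s + toℚ e)
        ≡⟨ cong₂ (λ u v → toℚ 2 * A * u + B * (v + toℚ e)) (coeff-choosePoly-leading e) (coeff-choosePoly-subleading e) ⟩
    toℚ 2 * A * 1ℚ + B * (- toℚ e + toℚ e)
        ≡⟨ simplify (toℚ 2) A B (toℚ e) ⟩
    toℚ 2 * A
        ∎
    where
    open ≡-Reasoning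
    F = toℚ (e !)
    A = toℚ (a e)
    B = toℚ (a (suc e))
    t = coeff (choosePoly e) e
    s = coeff (choosePoly (suc e)) e
    regroup : ∀ w F A B t s x → w * (F * (0ℚ + A * t + B * s)) + x * B ≡ w * A * (F * t) + B * (w * F * s + x)
    regroup = solve 7 (λ w F A B t s x → w :* (F :* (con 0ℚ :+ A :* t :+ B :* s)) :+ x :* B := w :* A :* (F :* t) :+ B :* (w :* F :* s :+ x)) refl
    simplify : ∀ w A B x → w * A * 1ℚ + B * (- x + x) ≡ w * A
    simplify = solve 4 (λ w A B x → w :* A :* con 1ℚ :+ B :* (:- x :+ x) := w :* A) refl

module LatticeWalks where
  open import Data.Nat as ℕ using (ℕ; zero; suc; _+_)
  import Data.Nat.Properties as ℕ
  open import Data.Integer as ℤ using (ℤ; +_; -[1+_]; ∣_∣)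
  import Data.Integer.Properties as ℤ
  open import Data.Fin using (Fin; zero; suc)
  open import Data.Bool using (Bool; true; false)
  open import Data.List as List using (List; []; _∷_)
  open import Data.List.Membership.Propositional using (_∈_; lose)
  open import Data.List.Membership.Propositional.Properties
    using (∈-map⁺; ∈-map⁻; ∈-concatMap⁺; ∈-deduplicate⁺; ∈-deduplicate⁻; ∈-cartesianProduct⁺; ∈-allFin)
  open import Data.List.Relation.Unary.Any using (here; there)
  open import Data.Vec using (Vec; []; _∷_; replicate; tabulate; zipWith)
  open import Data.Vec.Properties using (≡-dec; tabulate-∘)
  open import Data.Product using (Σ-syntax; _×_; _,_)
  open import Data.Sum using (_⊎_; inj₁; inj₂)
  open import Function using (_∘_)
  open import Relation.Binary.PropositionalEquality

  ‖_‖ : ∀ {d} → Point d → ℕ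
  ‖ []     ‖ = 0
  ‖ x ∷ xs ‖ = ∣ x ∣ + ‖ xs ‖

  ‖0‖≡0 : ∀ d → ‖ replicate d (+ 0) ‖ ≡ 0
  ‖0‖≡0 zero    = refl
  ‖0‖≡0 (suc d) = ‖0‖≡0 d

  ‖z‖≡0⇒z≡0 : ∀ {d} (z : Point d) → ‖ z ‖ ≡ 0 → z ≡ replicate d (+ 0)
  ‖z‖≡0⇒z≡0 []           _  = refl
  ‖z‖≡0⇒z≡0 (+ zero ∷ z) eq = cong (+ 0 ∷_) (‖z‖≡0⇒z≡0 z eq)

  infix 4 _≤₂_

  data _≤₂_ (m : ℕ) : ℕ → Set where
    ≤₂-refl : m ≤₂ m
    ≤₂-step : ∀ {n} → m ≤₂ n → m ≤₂ suc (suc n)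

  s≤₂s : ∀ {m n} → m ≤₂ n → suc m ≤₂ suc n
  s≤₂s ≤₂-refl      = ≤₂-refl
  s≤₂s (≤₂-step le) = ≤₂-step (s≤₂s le)

  s≤₂s⁻¹ : ∀ {m n} → suc m ≤₂ suc n → m ≤₂ n
  s≤₂s⁻¹ ≤₂-refl              = ≤₂-refl
  s≤₂s⁻¹ (≤₂-step {suc n} le) = ≤₂-step (s≤₂s⁻¹ le)

  1+m≤₂n⇒m≤₂1+n : ∀ {m n} → suc m ≤₂ n → m ≤₂ suc n
  1+m≤₂n⇒m≤₂1+n ≤₂-refl      = ≤₂-step ≤₂-refl
  1+m≤₂n⇒m≤₂1+n (≤₂-step le) = ≤₂-step (1+m≤₂n⇒m≤₂1+n le)

  sign : Bool → ℤ
  sign true  = + 1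
  sign false = -[1+ 0 ]

  infixr 5 _⊕_

  _⊕_ : ∀ {d} → Point d → Point d → Point d
  _⊕_ = zipWith ℤ._+_

  tabulate-0-⊕ : ∀ {d} (f : Fin d → ℤ) → (∀ j → f j ≡ + 0) → (y : Point d) → tabulate f ⊕ y ≡ y
  tabulate-0-⊕ f f≡0 []       = refl
  tabulate-0-⊕ f f≡0 (x ∷ xs) =
    cong₂ _∷_ (trans (cong (ℤ._+ x) (f≡0 zero)) (ℤ.+-identityˡ x)) (tabulate-0-⊕ (f ∘ suc) (f≡0 ∘ suc) xs)

  stepVec-zero-⊕ : ∀ {d} b x (xs : Point d) → stepVec (zero , b) ⊕ (x ∷ xs) ≡ sign b ℤ.+ x ∷ xs
  stepVec-zero-⊕ true  x xs = cong (_ ∷_) (tabulate-0-⊕ _ (λ _ → refl) xs)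
  stepVec-zero-⊕ false x xs = cong (_ ∷_) (trans (cong (_⊕ xs) (sym (tabulate-∘ ℤ.-_ _))) (tabulate-0-⊕ _ (λ _ → refl) xs))

  stepVec-suc-⊕ : ∀ {d} (i : Fin d) b x xs → stepVec (suc i , b) ⊕ (x ∷ xs) ≡ x ∷ stepVec (i , b) ⊕ xs
  stepVec-suc-⊕ i true  x xs = cong (_∷ _) (ℤ.+-identityˡ x)
  stepVec-suc-⊕ i false x xs = cong (_∷ _) (ℤ.+-identityˡ x)

  ∣sign+x∣ : ∀ b x → ∣ sign b ℤ.+ x ∣ ≡ suc ∣ x ∣ ⊎ suc ∣ sign b ℤ.+ x ∣ ≡ ∣ x ∣
  ∣sign+x∣ true  (+ n)        = inj₁ refl
  ∣sign+x∣ true  -[1+ zero ]  = inj₂ refl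
  ∣sign+x∣ true  -[1+ suc n ] = inj₂ refl
  ∣sign+x∣ false (+ zero)     = inj₁ refl
  ∣sign+x∣ false (+ suc n)    = inj₂ refl
  ∣sign+x∣ false -[1+ n ]     = inj₁ refl

  ‖step⊕y‖ : ∀ {d} (s : Step d) y → ‖ stepVec s ⊕ y ‖ ≡ suc ‖ y ‖ ⊎ suc ‖ stepVec s ⊕ y ‖ ≡ ‖ y ‖
  ‖step⊕y‖ (zero , b) (x ∷ xs) rewrite stepVec-zero-⊕ b x xs with ∣sign+x∣ b x
  ... | inj₁ eq = inj₁ (cong (_+ ‖ xs ‖) eq)
  ... | inj₂ eq = inj₂ (cong (_+ ‖ xs ‖) eq)
  ‖step⊕y‖ (suc i , b) (x ∷ xs) rewrite stepVec-suc-⊕ i b x xs with ‖step⊕y‖ (i , b) xs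
  ... | inj₁ eq = inj₁ (trans (cong (_+_ ∣ x ∣) eq) (ℕ.+-suc ∣ x ∣ ‖ xs ‖))
  ... | inj₂ eq = inj₂ (trans (sym (ℕ.+-suc ∣ x ∣ _)) (cong (_+_ ∣ x ∣) eq))

  ‖endpoint‖≤₂length : ∀ {d} n (w : Vec (Step d) n) → ‖ endpoint w ‖ ≤₂ n
  ‖endpoint‖≤₂length {d} zero    []      = subst (_≤₂ 0) (sym (‖0‖≡0 d)) ≤₂-refl
  ‖endpoint‖≤₂length     (suc n) (s ∷ w) with ‖step⊕y‖ s (endpoint w)
  ... | inj₁ eq = subst (_≤₂ suc n) (sym eq) (s≤₂s (‖endpoint‖≤₂length n w))
  ... | inj₂ eq = 1+m≤₂n⇒m≤₂1+n (subst (_≤₂ n) (sym eq) (‖endpoint‖≤₂length n w))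

  stepTowardOrigin : ∀ {d m} (z : Point d) → ‖ z ‖ ≡ suc m →
                     Σ[ s ∈ Step d ] Σ[ y ∈ Point d ] stepVec s ⊕ y ≡ z × ‖ y ‖ ≡ m
  stepTowardOrigin (+ zero ∷ z) eq with stepTowardOrigin z eq
  ... | (i , b) , y , refl , ‖y‖≡m = (suc i , b) , + 0 ∷ y , stepVec-suc-⊕ i b (+ 0) y , ‖y‖≡m
  stepTowardOrigin (+ suc k ∷ z) eq = (zero , true) , + k ∷ z , stepVec-zero-⊕ true (+ k) z , ℕ.suc-injective eq
  stepTowardOrigin (-[1+ k ] ∷ z) eq =
    (zero , false) , ℤ.- (+ k) ∷ z ,
    trans (stepVec-zero-⊕ false (ℤ.- (+ k)) z) (cong (_∷ z) (-1-k≡-[1+k] k)) ,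
    trans (cong (_+ ‖ z ‖) (ℤ.∣-i∣≡∣i∣ (+ k))) (ℕ.suc-injective eq)
    where
    -1-k≡-[1+k] : ∀ k → -[1+ 0 ] ℤ.+ ℤ.- (+ k) ≡ -[1+ k ]
    -1-k≡-[1+k] zero    = refl
    -1-k≡-[1+k] (suc k) = refl

  walkOfLength‖‖ : ∀ {d} m (z : Point d) → ‖ z ‖ ≡ m → Σ[ w ∈ Vec (Step d) m ] endpoint w ≡ z
  walkOfLength‖‖ zero    z eq = [] , sym (‖z‖≡0⇒z≡0 z eq)
  walkOfLength‖‖ (suc m) z eq with stepTowardOrigin z eq
  ... | s , y , refl , ‖y‖≡m with walkOfLength‖‖ m y ‖y‖≡m
  ...   | w , refl = s ∷ w , refl

  back-and-forth : ∀ {e} (y : Point (suc e)) → stepVec (zero , true) ⊕ stepVec (zero , false) ⊕ y ≡ y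
  back-and-forth (x ∷ xs) = begin
    stepVec (zero , true) ⊕ stepVec (zero , false) ⊕ (x ∷ xs) ≡⟨ cong (stepVec (zero , true) ⊕_) (stepVec-zero-⊕ false x xs) ⟩
    stepVec (zero , true) ⊕ (-[1+ 0 ] ℤ.+ x ∷ xs)            ≡⟨ stepVec-zero-⊕ true (-[1+ 0 ] ℤ.+ x) xs ⟩
    + 1 ℤ.+ (-[1+ 0 ] ℤ.+ x) ∷ xs                            ≡⟨ cong (_∷ xs) (sym (ℤ.+-assoc (+ 1) -[1+ 0 ] x)) ⟩
    + 0 ℤ.+ x ∷ xs                                           ≡⟨ cong (_∷ xs) (ℤ.+-identityˡ x) ⟩
    x ∷ xs                                                   ∎
    where open ≡-Reasoning

  ≤₂length⇒endpoint : ∀ {e n} (z : Point (suc e)) → ‖ z ‖ ≤₂ n → Σ[ w ∈ Vec (Step (suc e)) n ] endpoint w ≡ z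
  ≤₂length⇒endpoint z ≤₂-refl      = walkOfLength‖‖ _ z refl
  ≤₂length⇒endpoint z (≤₂-step le) with ≤₂length⇒endpoint z le
  ... | w , refl = (zero , true) ∷ (zero , false) ∷ w , back-and-forth (endpoint w)

  ∈-allSeqs : ∀ {A : Set} n (xs : List A) → (∀ x → x ∈ xs) → (w : Vec A n) → w ∈ allSeqs n xs
  ∈-allSeqs zero    xs ∈xs []      = here refl
  ∈-allSeqs (suc n) xs ∈xs (x ∷ w) =
    ∈-concatMap⁺ (λ y → List.map (y ∷_) (allSeqs n xs)) (lose (∈xs x) (∈-map⁺ (x ∷_) (∈-allSeqs n xs ∈xs w)))

  ∈-allSteps : ∀ d (s : Step d) → s ∈ allSteps d
  ∈-allSteps d (i , true)  = ∈-cartesianProduct⁺ (∈-allFin i) (here refl)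
  ∈-allSteps d (i , false) = ∈-cartesianProduct⁺ (∈-allFin i) (there (here refl))

  ∈Pset⇒‖‖≤₂ : ∀ d n z → z ∈ Pset d n → ‖ z ‖ ≤₂ n
  ∈Pset⇒‖‖≤₂ d n z z∈P with ∈-map⁻ endpoint (∈-deduplicate⁻ (≡-dec ℤ._≟_) _ z∈P)
  ... | w , _ , refl = ‖endpoint‖≤₂length n w

  ‖‖≤₂⇒∈Pset : ∀ e n z → ‖ z ‖ ≤₂ n → z ∈ Pset (suc e) n
  ‖‖≤₂⇒∈Pset e n z le with ≤₂length⇒endpoint z le
  ... | w , refl = ∈-deduplicate⁺ (≡-dec ℤ._≟_) (∈-map⁺ endpoint (∈-allSeqs n _ (∈-allSteps (suc e)) w))

module LatticePoints where
  open BinomialSums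
  open LatticeWalks
  open import Data.Nat as ℕ using (ℕ; zero; suc; _+_; _*_; _∸_; _≤_; z≤n; s≤s)
  import Data.Nat.Properties as ℕ
  open import Data.Nat.Tactic.RingSolver using (solve-∀)
  open import Data.Integer as ℤ using (ℤ; +_; -[1+_]; ∣_∣)
  open import Data.List as List using (List; []; _∷_; length; concatMap)
  import Data.List.Properties as List
  open import Data.List.Membership.Propositional using (_∈_; lose; find)
  open import Data.List.Membership.Propositional.Properties using (∈-map⁺; ∈-map⁻; ∈-concatMap⁺; ∈-concatMap⁻)
  open import Data.List.Membership.Propositional.Properties.WithK using (unique∧set⇒bag)
  open import Data.List.Relation.Binary.BagAndSetEquality using (∼bag⇒↭)
  open import Data.List.Relation.Binary.Permutation.Propositional.Properties using (↭-length)
  open import Data.List.Relation.Unary.Any using (here; there)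
  open import Data.List.Relation.Unary.All as All using ([]; _∷_)
  import Data.List.Relation.Unary.All.Properties as All
  open import Data.List.Relation.Unary.AllPairs as AllPairs using ([]; _∷_)
  import Data.List.Relation.Unary.AllPairs.Properties as AllPairs
  open import Data.List.Relation.Unary.Unique.Propositional using (Unique)
  import Data.List.Relation.Unary.Unique.Propositional.Properties as Unique
  open import Data.List.Relation.Unary.Unique.DecPropositional.Properties using (deduplicate-!)
  open import Data.Vec using ([]; _∷_)
  open import Data.Vec.Properties using (≡-dec; ∷-injectiveˡ; ∷-injectiveʳ)
  open import Data.Product using (_×_; _,_)
  open import Data.Sum using (inj₁; inj₂)
  open import Data.Empty using (⊥)
  open import Function.Bundles using (mk⇔)
  open import Relation.Binary.PropositionalEquality

  ball : ℕ → List ℤ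
  ball zero    = + 0 ∷ []
  ball (suc n) = + suc n ∷ -[1+ n ] ∷ ball n

  ∈ball⇒∣∣≤ : ∀ n {t} → t ∈ ball n → ∣ t ∣ ≤ n
  ∈ball⇒∣∣≤ zero    (here refl)         = z≤n
  ∈ball⇒∣∣≤ (suc n) (here refl)         = ℕ.≤-refl
  ∈ball⇒∣∣≤ (suc n) (there (here refl)) = ℕ.≤-refl
  ∈ball⇒∣∣≤ (suc n) (there (there t∈)) = ℕ.m≤n⇒m≤1+n (∈ball⇒∣∣≤ n t∈)

  ∣∣≤⇒∈ball : ∀ n t → ∣ t ∣ ≤ n → t ∈ ball n
  ∣∣≤⇒∈ball zero    (+ zero)   _         = here refl
  ∣∣≤⇒∈ball (suc n) (+ zero)   _         = there (there (∣∣≤⇒∈ball n (+ zero) z≤n))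
  ∣∣≤⇒∈ball (suc n) (+ suc k)  (s≤s k≤n) with ℕ.m≤n⇒m<n∨m≡n k≤n
  ... | inj₁ k<n  = there (there (∣∣≤⇒∈ball n (+ suc k) k<n))
  ... | inj₂ refl = here refl
  ∣∣≤⇒∈ball (suc n) -[1+ k ]   (s≤s k≤n) with ℕ.m≤n⇒m<n∨m≡n k≤n
  ... | inj₁ k<n  = there (there (∣∣≤⇒∈ball n -[1+ k ] k<n))
  ... | inj₂ refl = there (here refl)

  ball-unique : ∀ n → Unique (ball n)
  ball-unique zero    = [] ∷ []
  ball-unique (suc n) = ((λ ()) ∷ All.tabulate (outside refl)) ∷ All.tabulate (outside refl) ∷ ball-unique n
    where
    outside : ∀ {t} → ∣ t ∣ ≡ suc n → ∀ {u} → u ∈ ball n → t ≢ u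
    outside ∣t∣≡1+n u∈ refl = ℕ.1+n≰n (subst (_≤ n) ∣t∣≡1+n (∈ball⇒∣∣≤ n u∈))

  +-≤₂ : ∀ a {b n} → a ≤ n → b ≤₂ n ∸ a → a + b ≤₂ n
  +-≤₂ zero    _         le = le
  +-≤₂ (suc a) (s≤s a≤n) le = s≤₂s (+-≤₂ a a≤n le)

  +-≤₂⁻¹ : ∀ a {b n} → a + b ≤₂ n → a ≤ n × b ≤₂ n ∸ a
  +-≤₂⁻¹ zero              le = z≤n , le
  +-≤₂⁻¹ (suc a) {n = suc n} le with +-≤₂⁻¹ a (s≤₂s⁻¹ le)
  ... | a≤n , b≤₂n∸a = s≤s a≤n , b≤₂n∸a

  lattice : (d n : ℕ) → List (Point d)
  lattice zero    zero          = [] ∷ []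
  lattice zero    (suc zero)    = []
  lattice zero    (suc (suc n)) = lattice zero n
  lattice (suc d) n             = concatMap (λ t → List.map (t ∷_) (lattice d (n ∸ ∣ t ∣))) (ball n)

  ∈lattice⇒‖‖≤₂ : ∀ d n z → z ∈ lattice d n → ‖ z ‖ ≤₂ n
  ∈lattice⇒‖‖≤₂ zero    zero          [] _  = ≤₂-refl
  ∈lattice⇒‖‖≤₂ zero    (suc (suc n)) [] z∈ = ≤₂-step (∈lattice⇒‖‖≤₂ zero n [] z∈)
  ∈lattice⇒‖‖≤₂ (suc d) n             z  z∈
    with find (∈-concatMap⁻ (λ t → List.map (t ∷_) (lattice d (n ∸ ∣ t ∣))) {xs = ball n} z∈)
  ... | t , t∈ , z∈map with ∈-map⁻ (t ∷_) z∈map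
  ...   | y , y∈ , refl = +-≤₂ ∣ t ∣ (∈ball⇒∣∣≤ n t∈) (∈lattice⇒‖‖≤₂ d (n ∸ ∣ t ∣) y y∈)

  ‖‖≤₂⇒∈lattice : ∀ d n z → ‖ z ‖ ≤₂ n → z ∈ lattice d n
  ‖‖≤₂⇒∈lattice zero    zero          [] _            = here refl
  ‖‖≤₂⇒∈lattice zero    (suc (suc n)) [] (≤₂-step le) = ‖‖≤₂⇒∈lattice zero n [] le
  ‖‖≤₂⇒∈lattice (suc d) n             (t ∷ y) le with +-≤₂⁻¹ ∣ t ∣ le
  ... | ∣t∣≤n , ‖y‖≤₂ = ∈-concatMap⁺ (λ t → List.map (t ∷_) (lattice d (n ∸ ∣ t ∣)))
        (lose (∣∣≤⇒∈ball n t ∣t∣≤n) (∈-map⁺ (t ∷_) (‖‖≤₂⇒∈lattice d (n ∸ ∣ t ∣) y ‖y‖≤₂)))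

  lattice-unique : ∀ d n → Unique (lattice d n)
  lattice-unique zero    zero          = [] ∷ []
  lattice-unique zero    (suc zero)    = []
  lattice-unique zero    (suc (suc n)) = lattice-unique zero n
  lattice-unique (suc d) n             =
    Unique.concat⁺ (All.map⁺ (All.tabulate (λ {t} _ → Unique.map⁺ ∷-injectiveʳ (lattice-unique d (n ∸ ∣ t ∣)))))
                   (AllPairs.map⁺ (AllPairs.map disjoint (ball-unique n)))
    where
    disjoint : ∀ {t u} → t ≢ u → ∀ {z} → z ∈ List.map (t ∷_) (lattice d (n ∸ ∣ t ∣)) × z ∈ List.map (u ∷_) (lattice d (n ∸ ∣ u ∣)) → ⊥
    disjoint t≢u (z∈t , z∈u) with ∈-map⁻ _ z∈t | ∈-map⁻ _ z∈u
    ... | _ , _ , refl | _ , _ , eq = t≢u (∷-injectiveˡ eq)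

  count : ℕ → ℕ → ℕ
  count d n = length (lattice d n)

  length-concatMap-ball : ∀ {d} (g : ℕ → List (Point d)) n →
    length (concatMap (λ t → List.map (t ∷_) (g ∣ t ∣)) (ball n)) ≡ length (g 0) + 2 * (∑[ k < n ] length (g (suc k)))
  length-concatMap-ball g zero    = trans (List.length-++ (List.map (+ 0 ∷_) (g 0))) (cong (_+ 0) (List.length-map _ (g 0)))
  length-concatMap-ball g (suc n) = begin
    length (List.map (+ suc n ∷_) (g (suc n)) List.++ (List.map (-[1+ n ] ∷_) (g (suc n)) List.++ rest))
      ≡⟨ List.length-++ (List.map (+ suc n ∷_) (g (suc n))) ⟩
    length (List.map (+ suc n ∷_) (g (suc n))) + length (List.map (-[1+ n ] ∷_) (g (suc n)) List.++ rest)
      ≡⟨ cong₂ _+_ (List.length-map _ (g (suc n))) (List.length-++ (List.map (-[1+ n ] ∷_) (g (suc n)))) ⟩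
    length (g (suc n)) + (length (List.map (-[1+ n ] ∷_) (g (suc n))) + length rest)
      ≡⟨ cong₂ (λ u v → length (g (suc n)) + (u + v)) (List.length-map _ (g (suc n))) (length-concatMap-ball g n) ⟩
    length (g (suc n)) + (length (g (suc n)) + (length (g 0) + 2 * (∑[ k < n ] length (g (suc k)))))
      ≡⟨ regroup (length (g (suc n))) (length (g 0)) (∑[ k < n ] length (g (suc k))) ⟩
    length (g 0) + 2 * (∑[ k < suc n ] length (g (suc k)))
      ∎
    where
    open ≡-Reasoning
    rest = concatMap (λ t → List.map (t ∷_) (g ∣ t ∣)) (ball n)
    regroup : ∀ x y s → x + (x + (y + 2 * s)) ≡ y + 2 * (s + x)
    regroup = solve-∀

  count-suc : ∀ d n → count (suc d) n ≡ count d n + 2 * (∑[ k < n ] count d k)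
  count-suc d n = trans (length-concatMap-ball (λ k → lattice d (n ∸ k)) n)
                        (cong (λ s → count d n + 2 * s) (∑-reverse n (count d)))

  count-zero-alternates : ∀ n → count 0 n + count 0 (suc n) ≡ 1
  count-zero-alternates zero          = refl
  count-zero-alternates (suc zero)    = refl
  count-zero-alternates (suc (suc n)) = count-zero-alternates n

  count-one : ∀ n → count 1 n ≡ suc n
  count-one n = trans (count-suc 0 n) (go n)
    where
    go : ∀ n → count 0 n + 2 * (∑[ k < n ] count 0 k) ≡ suc n
    go zero    = refl
    go (suc n) = begin
      count 0 (suc n) + 2 * ((∑[ k < n ] count 0 k) + count 0 n)                ≡⟨ regroup (count 0 (suc n)) (count 0 n) (∑[ k < n ] count 0 k) ⟩
      (count 0 n + 2 * (∑[ k < n ] count 0 k)) + (count 0 n + count 0 (suc n))  ≡⟨ cong₂ _+_ (go n) (count-zero-alternates n) ⟩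
      suc n + 1                                                                 ≡⟨ ℕ.+-comm (suc n) 1 ⟩
      suc (suc n)                                                               ∎
      where
      open ≡-Reasoning
      regroup : ∀ a b s → a + 2 * (s + b) ≡ (b + 2 * s) + (b + a)
      regroup = solve-∀

  count≡countExpansion : ∀ e n → count (suc e) n ≡ countExpansion e n
  count≡countExpansion zero    n = trans (count-one n) (sym (countExpansion-zero n))
  count≡countExpansion (suc e) n = begin
    count (2 + e) n                                           ≡⟨ count-suc (suc e) n ⟩
    count (suc e) n + 2 * (∑[ k < n ] count (suc e) k)        ≡⟨ cong₂ (λ u v → u + 2 * v) (count≡countExpansion e n) (∑-cong n (count≡countExpansion e)) ⟩
    countExpansion e n + 2 * (∑[ k < n ] countExpansion e k)  ≡⟨ sym (countExpansion-suc e n) ⟩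
    countExpansion (suc e) n                                  ∎
    where open ≡-Reasoning

  unique-same-members⇒same-length : ∀ {A : Set} {xs ys : List A} → Unique xs → Unique ys →
    (∀ {z} → z ∈ xs → z ∈ ys) → (∀ {z} → z ∈ ys → z ∈ xs) → length xs ≡ length ys
  unique-same-members⇒same-length xs! ys! xs⊆ys ys⊆xs = ↭-length (∼bag⇒↭ (unique∧set⇒bag xs! ys! (mk⇔ xs⊆ys ys⊆xs)))

  cardP≡count : ∀ e n → cardP (suc e) n ≡ count (suc e) n
  cardP≡count e n = unique-same-members⇒same-length (deduplicate-! (≡-dec ℤ._≟_) _) (lattice-unique (suc e) n)
    (λ {z} z∈ → ‖‖≤₂⇒∈lattice (suc e) n z (∈Pset⇒‖‖≤₂ (suc e) n z z∈))
    (λ {z} z∈ → ‖‖≤₂⇒∈Pset e n z (∈lattice⇒‖‖≤₂ (suc e) n z z∈))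

module CountPolynomial where
  open BinomialSums
  open RationalPolynomials
  open LatticePoints
  open import Data.Nat as ℕ using (ℕ; suc; _^_; _!)
  open import Data.Rational using (_+_; _*_; _-_)
  open import Data.Rational.Solver using (module +-*-Solver)
  open +-*-Solver using (solve; _:=_; _:+_; _:-_; _:*_)
  open import Relation.Binary.PropositionalEquality

  countPoly : ℕ → Poly
  countPoly e = combination (countCoeff e) (2 ℕ.+ e)

  eval-countPoly : ∀ e n → eval (countPoly e) (toℚ n) ≡ toℚ (cardP (suc e) n)
  eval-countPoly e n = trans (eval-combination (countCoeff e) (2 ℕ.+ e) n)
                             (cong toℚ (sym (trans (cardP≡count e n) (count≡countExpansion e n))))

  coeff-countPoly-subleading : ∀ e → toℚ (e !) * coeff (countPoly e) e ≡ toℚ (2 ^ e)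
  coeff-countPoly-subleading e = *-cancelˡ (toℚ-suc≢0 1) (begin
    toℚ 2 * X                                               ≡⟨ sym (cancel (toℚ 2 * X) (toℚ e * P)) ⟩
    toℚ 2 * X + toℚ e * P - toℚ e * P                       ≡⟨ cong (λ u → toℚ 2 * X + toℚ e * toℚ u - toℚ e * P) (sym (countCoeff-top e)) ⟩
    toℚ 2 * X + toℚ e * toℚ (countCoeff e (suc e)) - toℚ e * P
                                                            ≡⟨ cong (_- toℚ e * P) (coeff-combination-subleading (countCoeff e) e) ⟩
    toℚ 2 * toℚ (countCoeff e e) - toℚ e * P                ≡⟨ cong (_- toℚ e * P) (sym (toℚ-* 2 (countCoeff e e))) ⟩
    toℚ (2 ℕ.* countCoeff e e) - toℚ e * P                    ≡⟨ cong (λ u → toℚ u - toℚ e * P) (countCoeff-diag e) ⟩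
    toℚ ((e ℕ.+ 2) ℕ.* 2 ^ e) - toℚ e * P                       ≡⟨ cong (_- toℚ e * P) (trans (toℚ-* (e ℕ.+ 2) (2 ^ e)) (cong (_* P) (toℚ-+ e 2))) ⟩
    (toℚ e + toℚ 2) * P - toℚ e * P                         ≡⟨ simplify (toℚ e) (toℚ 2) P ⟩
    toℚ 2 * P                                               ∎)
    where
    open ≡-Reasoning
    X = toℚ (e !) * coeff (countPoly e) e
    P = toℚ (2 ^ e)
    cancel : ∀ x y → x + y - y ≡ x
    cancel = solve 2 (λ x y → x :+ y :- y := x) refl
    simplify : ∀ x y p → (x + y) * p - x * p ≡ y * p
    simplify = solve 3 (λ x y p → (x :+ y) :* p :- x :* p := y :* p) refl

open import Data.Nat using (ℕ; _≤_; _∸_; suc; _^_; _!)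
open import Data.Nat.Properties using (_!≢0)
open import Data.Rational using (ℚ; _/_; _*_)
open import Data.Integer using (+_)
open import Relation.Binary.PropositionalEquality using (_≡_; trans; sym; cong; module ≡-Reasoning)
open RationalPolynomials using (toℚ; toℚ-*-cancel; coeff-unique)
open CountPolynomial

mainTheorem6 : (d : ℕ) → 1 ≤ d → (Q : Poly) →
    ((n : ℕ) → eval Q ((+ n) / 1) ≡ (+ cardP d n) / 1) →
    coeff Q (d ∸ 1) ≡ twoPowOverFact (d ∸ 1)
mainTheorem6 (suc e) _ Q Q≗cardP = toℚ-*-cancel (2 ^ e) (e !) {{e !≢0}} (begin
  toℚ (e !) * coeff Q e               ≡⟨ cong (toℚ (e !) *_) (coeff-unique Q (countPoly e) Q≗countPoly e) ⟩
  toℚ (e !) * coeff (countPoly e) e   ≡⟨ coeff-countPoly-subleading e ⟩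
  toℚ (2 ^ e)                         ∎)
  where
  open ≡-Reasoning
  Q≗countPoly : ∀ n → eval Q (toℚ n) ≡ eval (countPoly e) (toℚ n)
  Q≗countPoly n = trans (Q≗cardP n) (sym (eval-countPoly e n))
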